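{- Let $G$ be a connected finite simple graph of order $n$ with minimum degree $\delta(G)=1$. Then $Z(G)+Z(\overline{G})=\delta(G)+\delta(\overline{G})$ if and only if $G$ is the path $P_n$ with $n \ge 4$.
   Context: For a finite simple graph $G$, color a set $S\subseteq V(G)$ black and all other vertices white. The color-change rule: if a black vertex $u$ has exactly one white neighbor $w$, then $w$ is turned black. $S$ is a zero forcing set if repeated application of the rule eventually turns all vertices black; $Z(G)$ is the minimum size of a zero forcing set. $\overline{G}$ denotes the complement of $G$ and $\delta(\cdot)$ the minimum degree. $P_n$ is the path on $n$ vertices. -}

module Defs where

open import Data.Bool using (Bool; true; false; not; _∧_; _∨_)
open import Data.Bool.Properties using (∨-comm)
open import Data.Nat using (ℕ; suc; _≤_)
open import Data.Nat.Properties using (1+n≢n)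
open import Data.Fin using (Fin; toℕ)
open import Data.Fin.Properties using () renaming (_≟_ to _≟ᶠ_)
open import Data.Fin.Subset using (Subset; _∈_; ∣_∣)
open import Data.Vec using (tabulate)
open import Data.Product using (Σ; ∃; _×_; _,_)
open import Function.Bundles using (_↔_; Inverse)
open import Relation.Binary.PropositionalEquality using (_≡_; _≢_; refl; sym; cong₂)
open import Relation.Nullary.Decidable using (dec-false; does)
import Relation.Nullary
import Data.Empty

record Graph (n : ℕ) : Set where
  field
    adj     : Fin n → Fin n → Bool
    adj-sym : ∀ u v → adj u v ≡ adj v u
    irrefl  : ∀ v → adj v v ≡ false
open Graph public

Adj : ∀ {n} → Graph n → Fin n → Fin n → Set
Adj G u v = adj G u v ≡ true

complement : ∀ {n} → Graph n → Graph n
complement {n} G = record { adj = a ; adj-sym = s ; irrefl = i }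
  where
  a : Fin n → Fin n → Bool
  a u v = not (adj G u v) ∧ not (does (u ≟ᶠ v))
  s : ∀ u v → a u v ≡ a v u
  s u v with u ≟ᶠ v | v ≟ᶠ u
  ... | Relation.Nullary.yes _ | Relation.Nullary.yes _ rewrite adj-sym G u v = refl
  ... | Relation.Nullary.no _  | Relation.Nullary.no _  rewrite adj-sym G u v = refl
  ... | Relation.Nullary.yes p | Relation.Nullary.no ¬q = Data.Empty.⊥-elim (¬q (sym p))
  ... | Relation.Nullary.no ¬p | Relation.Nullary.yes q = Data.Empty.⊥-elim (¬p (sym q))
  i : ∀ v → a v v ≡ false
  i v with v ≟ᶠ v
  ... | Relation.Nullary.yes _ with adj G v v
  ...   | true  = refl
  ...   | false = refl
  i v | Relation.Nullary.no ¬p = Data.Empty.⊥-elim (¬p refl)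

neighbourhood : ∀ {n} → Graph n → Fin n → Subset n
neighbourhood G v = tabulate (adj G v)

degree : ∀ {n} → Graph n → Fin n → ℕ
degree G v = ∣ neighbourhood G v ∣

IsMinDegree : ∀ {n} → Graph n → ℕ → Set
IsMinDegree G d = (∃ λ v → degree G v ≡ d) × (∀ v → d ≤ degree G v)

data Reachable {n} (G : Graph n) : Fin n → Fin n → Set where
  here : ∀ {v} → Reachable G v v
  step : ∀ {u w v} → Adj G u w → Reachable G w v → Reachable G u v

Connected : ∀ {n} → Graph n → Set
Connected G = ∀ u v → Reachable G u v

-- Vertices turned black starting from the black set S under the colour-change
-- rule (least set containing S closed under the rule).
data Black {n} (G : Graph n) (S : Subset n) : Fin n → Set where
  init  : ∀ {v} → v ∈ S → Black G S v
  force : ∀ {u w} → Black G S u → Adj G u w →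
          (∀ x → Adj G u x → x ≢ w → Black G S x) → Black G S w

IsZeroForcingSet : ∀ {n} → Graph n → Subset n → Set
IsZeroForcingSet G S = ∀ v → Black G S v

IsZeroForcingNumber : ∀ {n} → Graph n → ℕ → Set
IsZeroForcingNumber G k =
  (∃ λ S → IsZeroForcingSet G S × ∣ S ∣ ≡ k) ×
  (∀ S → IsZeroForcingSet G S → k ≤ ∣ S ∣)

path : (n : ℕ) → Graph n
path n = record { adj = a ; adj-sym = s ; irrefl = i }
  where
  open import Data.Nat.Properties using () renaming (_≟_ to _≟ℕ_)
  a : Fin n → Fin n → Bool
  a u v = does (suc (toℕ u) ≟ℕ toℕ v) ∨ does (suc (toℕ v) ≟ℕ toℕ u)
  s : ∀ u v → a u v ≡ a v u
  s u v = ∨-comm (does (suc (toℕ u) ≟ℕ toℕ v)) (does (suc (toℕ v) ≟ℕ toℕ u))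
  i : ∀ v → a v v ≡ false
  i v rewrite dec-false (suc (toℕ v) ≟ℕ toℕ v) 1+n≢n = refl

_≅_ : ∀ {n} → Graph n → Graph n → Set
_≅_ {n} G H = Σ (Fin n ↔ Fin n) λ f →
  ∀ u v → adj G u v ≡ adj H (Inverse.to f u) (Inverse.to f v)

-- Every graph has Z(H) ≥ δ(H): the vertex performing the first force out of a zero forcing
-- set S has all of its neighbours but one in S. Since also Z(G) ≥ 1 = δ(G), the equation
-- Z(G) + Z(Ḡ) = 1 + δ(Ḡ) holds exactly when Z(G) = 1 and Z(Ḡ) = δ(Ḡ). A single black vertex
-- can only force along one chain, and when a chain vertex forces, all its other neighbours are
-- earlier chain vertices; so Z(G) = 1 makes G a path. Conversely Z(Pₙ) = 1; the complement of
-- P₂ or P₃ has an isolated vertex although Z ≥ 1, while for n ≥ 4 an explicit forcing set of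
-- size n − 3 shows Z(P̄ₙ) ≤ n − 3 ≤ δ(P̄ₙ).

module Submission where

open import Defs
open import Data.Bool using (Bool; true; false; _∨_; if_then_else_)
open import Data.Bool.Properties using (∨-comm; ¬-not)
open import Data.Empty using (⊥-elim)
open import Data.Fin as Fin using (Fin; toℕ; fromℕ<)
import Data.Fin.Properties as Finₚ
open import Data.Fin.Subset using (Subset; _∈_; _∉_; ∣_∣; _∪_; _-_; ⁅_⁆; ∁; ⊤; _⊆_; Nonempty; Empty)
open import Data.Fin.Subset.Properties
open import Data.Nat using (ℕ; zero; suc; pred; _+_; _∸_; _≤_; _<_; _≥_; z≤n; s≤s; s≤s⁻¹; NonZero; >-nonZero)
open import Data.Nat.Properties
open import Data.Product using (∃-syntax; _×_; _,_; proj₁; proj₂)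
open import Data.Sum using (_⊎_; inj₁; inj₂)
open import Data.Vec using ([]; _∷_; tabulate)
open import Data.Vec.Properties using (lookup∘tabulate; []=⇒lookup; lookup⇒[]=)
open import Function using (_∘_)
open import Function.Bundles using (_⇔_; mk⇔; Inverse; mk↔ₛ′)
open import Relation.Binary.PropositionalEquality
open import Relation.Nullary using (¬_; Dec; yes; no; does)
open import Relation.Nullary.Decidable using (dec-true; dec-false; ¬?; _×-dec_)

private
  variable
    A : Set
    n k i j : ℕ
    p S T : Subset n
    u v w x y z : Fin n

≤-suc-cases : i ≤ suc k → i ≤ k ⊎ i ≡ suc k
≤-suc-cases i≤k+1 with m≤n⇒m<n∨m≡n i≤k+1
... | inj₁ i<k+1 = inj₁ (s≤s⁻¹ i<k+1)
... | inj₂ i≡k+1 = inj₂ i≡k+1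

∈-tabulate⁺ : (f : Fin n → Bool) → f x ≡ true → x ∈ tabulate f
∈-tabulate⁺ {x = x} f fx = lookup⇒[]= x (tabulate f) (trans (lookup∘tabulate f x) fx)

∈-tabulate⁻ : (f : Fin n → Bool) → x ∈ tabulate f → f x ≡ true
∈-tabulate⁻ {x = x} f x∈ = trans (sym (lookup∘tabulate f x)) ([]=⇒lookup x∈)

∣p∪q∣≤∣p∣+∣q∣ : (p q : Subset n) → ∣ p ∪ q ∣ ≤ ∣ p ∣ + ∣ q ∣
∣p∪q∣≤∣p∣+∣q∣ []          []          = z≤n
∣p∪q∣≤∣p∣+∣q∣ (true ∷ p)  (true ∷ q)  = s≤s (≤-trans (∣p∪q∣≤∣p∣+∣q∣ p q) (+-monoʳ-≤ ∣ p ∣ (n≤1+n _)))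
∣p∪q∣≤∣p∣+∣q∣ (true ∷ p)  (false ∷ q) = s≤s (∣p∪q∣≤∣p∣+∣q∣ p q)
∣p∪q∣≤∣p∣+∣q∣ (false ∷ p) (true ∷ q)  = ≤-trans (s≤s (∣p∪q∣≤∣p∣+∣q∣ p q)) (≤-reflexive (sym (+-suc ∣ p ∣ ∣ q ∣)))
∣p∪q∣≤∣p∣+∣q∣ (false ∷ p) (false ∷ q) = ∣p∪q∣≤∣p∣+∣q∣ p q

x∈p⇒1≤∣p∣ : x ∈ p → 1 ≤ ∣ p ∣
x∈p⇒1≤∣p∣ x∈p = ≤-trans (s≤s z≤n) (x∈p⇒∣p-x∣<∣p∣ x∈p)

x,y∈p⇒2≤∣p∣ : x ∈ p → y ∈ p → x ≢ y → 2 ≤ ∣ p ∣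
x,y∈p⇒2≤∣p∣ x∈p y∈p x≢y =
  ≤-trans (s≤s (x∈p⇒1≤∣p∣ (x∈p∧x≢y⇒x∈p-y y∈p (x≢y ∘ sym)))) (x∈p⇒∣p-x∣<∣p∣ x∈p)

x,y,z∈p⇒3≤∣p∣ : x ∈ p → y ∈ p → z ∈ p → x ≢ y → x ≢ z → y ≢ z → 3 ≤ ∣ p ∣
x,y,z∈p⇒3≤∣p∣ x∈p y∈p z∈p x≢y x≢z y≢z =
  ≤-trans (s≤s (x,y∈p⇒2≤∣p∣ (x∈p∧x≢y⇒x∈p-y y∈p (x≢y ∘ sym)) (x∈p∧x≢y⇒x∈p-y z∈p (x≢z ∘ sym)) y≢z))
          (x∈p⇒∣p-x∣<∣p∣ x∈p)

Empty⇒∣p∣≡0 : Empty p → ∣ p ∣ ≡ 0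
Empty⇒∣p∣≡0 {n} empty = trans (cong ∣_∣ (Empty-unique empty)) (∣⊥∣≡0 n)

subsingleton⇒∣p∣≤1 : (∀ {x y} → x ∈ p → y ∈ p → x ≡ y) → ∣ p ∣ ≤ 1
subsingleton⇒∣p∣≤1 {p = p} unique with nonempty? p
... | yes (x , x∈p) = ≤-trans (p⊆q⇒∣p∣≤∣q∣ (λ y∈p → subst (_∈ ⁅ x ⁆) (unique x∈p y∈p) (x∈⁅x⁆ x)))
                              (≤-reflexive (∣⁅x⁆∣≡1 x))
... | no empty      = ≤-trans (≤-reflexive (Empty⇒∣p∣≡0 empty)) z≤n

∣p∣≡1⇒p⊆⁅x⁆ : ∣ p ∣ ≡ 1 → x ∈ p → p ⊆ ⁅ x ⁆
∣p∣≡1⇒p⊆⁅x⁆ {x = x} ∣p∣≡1 x∈p {y} y∈p with y Finₚ.≟ x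
... | yes refl = x∈⁅x⁆ x
... | no y≢x   = ⊥-elim (1+n≰n (≤-trans (x,y∈p⇒2≤∣p∣ x∈p y∈p (y≢x ∘ sym)) (≤-reflexive ∣p∣≡1)))

Adj⇒≢ : (G : Graph n) → Adj G u v → u ≢ v
Adj⇒≢ {u = u} G uv refl with trans (sym uv) (irrefl G u)
... | ()

isolated⇒degree≡0 : (G : Graph n) → (∀ x → ¬ Adj G v x) → degree G v ≡ 0
isolated⇒degree≡0 G isolated = Empty⇒∣p∣≡0 λ (x , x∈N) → isolated x (∈-tabulate⁻ _ x∈N)

complement-adj⁻ : (G : Graph n) → Adj (complement G) u v → adj G u v ≡ false × u ≢ v
complement-adj⁻ {u = u} {v = v} G uv with adj G u v | u Finₚ.≟ v
... | false | no u≢v = refl , u≢v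
complement-adj⁻ G () | false | yes _
complement-adj⁻ G () | true  | _

complement-adj⁺ : (G : Graph n) → adj G u v ≡ false → u ≢ v → Adj (complement G) u v
complement-adj⁺ {u = u} {v = v} G ¬uv u≢v rewrite ¬uv | dec-false (u Finₚ.≟ v) u≢v = refl

complement-degree≥ : (G : Graph n) (v : Fin n) → n ∸ suc (degree G v) ≤ degree (complement G) v
complement-degree≥ {n} G v = begin
  n ∸ suc (degree G v)  ≤⟨ ∸-monoʳ-≤ n ∣closed∣≤ ⟩
  n ∸ ∣ closed ∣        ≡⟨ ∣∁p∣≡n∸∣p∣ closed ⟨
  ∣ ∁ closed ∣          ≤⟨ p⊆q⇒∣p∣≤∣q∣ ∁closed⊆Nᶜ ⟩
  degree (complement G) v ∎
  where
  open ≤-Reasoning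
  N closed : Subset n
  N      = neighbourhood G v
  closed = ⁅ v ⁆ ∪ N
  ∣closed∣≤ : ∣ closed ∣ ≤ suc (degree G v)
  ∣closed∣≤ = ≤-trans (∣p∪q∣≤∣p∣+∣q∣ ⁅ v ⁆ N) (≤-reflexive (cong (_+ ∣ N ∣) (∣⁅x⁆∣≡1 v)))
  ∁closed⊆Nᶜ : ∁ closed ⊆ neighbourhood (complement G) v
  ∁closed⊆Nᶜ {x} x∈∁closed = ∈-tabulate⁺ _ (complement-adj⁺ G (¬-not (x∉closed ∘ q⊆p∪q ⁅ v ⁆ N ∘ ∈-tabulate⁺ _))
                                                            (λ v≡x → x∉closed (p⊆p∪q N (subst (_∈ ⁅ v ⁆) v≡x (x∈⁅x⁆ v)))))
    where
    x∉closed : x ∉ closed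
    x∉closed = x∈∁p⇒x∉p x∈∁closed

Black-mono : {G : Graph n} → S ⊆ T → Black G S v → Black G T v
Black-mono S⊆T (init v∈S)          = init (S⊆T v∈S)
Black-mono S⊆T (force bu uw rest) = force (Black-mono S⊆T bu) uw (λ x ux x≢w → Black-mono S⊆T (rest x ux x≢w))

Black⇒Nonempty : {G : Graph n} → Black G S v → Nonempty S
Black⇒Nonempty (init v∈S)       = _ , v∈S
Black⇒Nonempty (force bu _ _) = Black⇒Nonempty bu

record EscapingForce (G : Graph n) (B : Fin n → Set) : Set where
  field
    {source target} : Fin n
    source∈B        : B source
    target∉B        : ¬ B target
    edge            : Adj G source target
    others∈B        : ∀ x → Adj G source x → x ≢ target → B x

-- Walk back along the derivation of a black vertex outside B to the first force that leaves B.
escapingForce : {G : Graph n} {B : Fin n → Set} → (∀ x → Dec (B x)) → (∀ {x} → x ∈ S → B x) →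
                Black G S v → ¬ B v → EscapingForce G B
escapingForce B? S⊆B (init v∈S) v∉B = ⊥-elim (v∉B (S⊆B v∈S))
escapingForce {G = G} {B = B} B? S⊆B (force {u} {w} bu uw rest) w∉B with B? u
... | no u∉B  = escapingForce B? S⊆B bu u∉B
... | yes u∈B with Finₚ.any? (λ x → (adj G u x Data.Bool.≟ true) ×-dec ¬? (x Finₚ.≟ w) ×-dec ¬? (B? x))
...   | yes (x , ux , x≢w , x∉B) = escapingForce B? S⊆B (rest x ux x≢w) x∉B
...   | no none = record { source∈B = u∈B ; target∉B = w∉B ; edge = uw ; others∈B = others∈B }
  where
  others∈B : ∀ x → Adj G u x → x ≢ w → B x
  others∈B x ux x≢w with B? x
  ... | yes x∈B = x∈B
  ... | no x∉B  = ⊥-elim (none (x , ux , x≢w , x∉B))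

-- Unless S is everything, the first force u → w out of S has N(u) ⊆ (S - u) ∪ {w}.
minDegree≤∣zeroForcingSet∣ : {G : Graph n} {d : ℕ} → IsMinDegree G d → IsZeroForcingSet G S → d ≤ ∣ S ∣
minDegree≤∣zeroForcingSet∣ {n} {S} {G} {d} ((v , _) , d≤deg) zfs with Finₚ.all? (_∈? S)
... | yes all∈S = begin
  d           ≤⟨ d≤deg v ⟩
  degree G v  ≤⟨ ∣p∣≤n (neighbourhood G v) ⟩
  n           ≡⟨ ∣⊤∣≡n n ⟨
  ∣ ⊤ {n} ∣   ≤⟨ p⊆q⇒∣p∣≤∣q∣ {p = ⊤} (λ {y} _ → all∈S y) ⟩
  ∣ S ∣       ∎
  where open ≤-Reasoning
... | no ¬all∈S with Finₚ.¬∀⟶∃¬ n _ (_∈? S) ¬all∈S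
...   | x , x∉S = begin
  d                                  ≤⟨ d≤deg source ⟩
  degree G source                    ≤⟨ p⊆q⇒∣p∣≤∣q∣ N⊆ ⟩
  ∣ (S - source) ∪ ⁅ target ⁆ ∣      ≤⟨ ∣p∪q∣≤∣p∣+∣q∣ (S - source) ⁅ target ⁆ ⟩
  ∣ S - source ∣ + ∣ ⁅ target ⁆ ∣    ≡⟨ cong (∣ S - source ∣ +_) (∣⁅x⁆∣≡1 target) ⟩
  ∣ S - source ∣ + 1                 ≡⟨ +-comm _ 1 ⟩
  suc ∣ S - source ∣                 ≤⟨ x∈p⇒∣p-x∣<∣p∣ source∈B ⟩
  ∣ S ∣                              ∎
  where
  open ≤-Reasoning
  open EscapingForce (escapingForce (_∈? S) (λ x∈S → x∈S) (zfs x) x∉S)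
  N⊆ : neighbourhood G source ⊆ (S - source) ∪ ⁅ target ⁆
  N⊆ {y} y∈N with y Finₚ.≟ target
  ... | yes refl = q⊆p∪q (S - source) _ (x∈⁅x⁆ y)
  ... | no y≢target = p⊆p∪q _ (x∈p∧x≢y⇒x∈p-y (others∈B y source~y y≢target) (Adj⇒≢ G source~y ∘ sym))
    where
    source~y : Adj G source y
    source~y = ∈-tabulate⁻ _ y∈N

minDegree≤zeroForcingNumber : {G : Graph n} {d z : ℕ} → IsMinDegree G d → IsZeroForcingNumber G z → d ≤ z
minDegree≤zeroForcingNumber {d = d} δ ((S , zfs , ∣S∣≡z) , _) = subst (d ≤_) ∣S∣≡z (minDegree≤∣zeroForcingSet∣ δ zfs)

1≤zeroForcingNumber : {G : Graph n} {z : ℕ} → Fin n → IsZeroForcingNumber G z → 1 ≤ z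
1≤zeroForcingNumber v ((S , zfs , refl) , _) = x∈p⇒1≤∣p∣ (proj₂ (Black⇒Nonempty (zfs v)))

zeroForcingNumber≡1⇒singleton : {G : Graph n} → IsZeroForcingNumber G 1 → ∃[ s ] IsZeroForcingSet G ⁅ s ⁆
zeroForcingNumber≡1⇒singleton ((S , zfs , ∣S∣≡1) , _) with nonempty? S
... | yes (s , s∈S) = s , λ v → Black-mono (∣p∣≡1⇒p⊆⁅x⁆ ∣S∣≡1 s∈S) (zfs v)
... | no empty      = ⊥-elim (0≢1+n (trans (sym (Empty⇒∣p∣≡0 empty)) ∣S∣≡1))

-- adj (path n) u v unfolds to consecutive (toℕ u) (toℕ v).
consecutive : ℕ → ℕ → Bool
consecutive i j = does (suc i ≟ j) ∨ does (suc j ≟ i)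

consecutive-sym : ∀ i j → consecutive i j ≡ consecutive j i
consecutive-sym i j = ∨-comm (does (suc i ≟ j)) (does (suc j ≟ i))

consecutive-suc : ∀ i → consecutive i (suc i) ≡ true
consecutive-suc i rewrite dec-true (suc i ≟ suc i) refl = refl

consecutive-false : suc i ≢ j → suc j ≢ i → consecutive i j ≡ false
consecutive-false {i} {j} i+1≢j j+1≢i rewrite dec-false (suc i ≟ j) i+1≢j | dec-false (suc j ≟ i) j+1≢i = refl

consecutive-irrefl : ∀ i → consecutive i i ≡ false
consecutive-irrefl i = consecutive-false {i} {i} 1+n≢n 1+n≢n

consecutive⁻ : ∀ i j → consecutive i j ≡ true → suc i ≡ j ⊎ suc j ≡ i
consecutive⁻ i j c with suc i ≟ j | suc j ≟ i
... | yes i+1≡j | _         = inj₁ i+1≡j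
... | no _      | yes j+1≡i = inj₂ j+1≡i
... | no i+1≢j  | no j+1≢i  with trans (sym c) (consecutive-false i+1≢j j+1≢i)
...   | ()

module PathLabelling (G : Graph n) (σ : G ≅ path n) where
  private
    open module σ = Inverse (proj₁ σ) using (to; from; strictlyInverseˡ; strictlyInverseʳ)

  pos : Fin n → ℕ
  pos u = toℕ (to u)

  pos-injective : pos u ≡ pos v → u ≡ v
  pos-injective {u} {v} pu≡pv = begin
    u            ≡⟨ strictlyInverseʳ u ⟨
    from (to u)  ≡⟨ cong from (Finₚ.toℕ-injective pu≡pv) ⟩
    from (to v)  ≡⟨ strictlyInverseʳ v ⟩
    v            ∎
    where open ≡-Reasoning

  pos<n : ∀ u → pos u < n
  pos<n u = Finₚ.toℕ<n (to u)

  vertexAt : k < n → ∃[ u ] pos u ≡ k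
  vertexAt k<n = from (fromℕ< k<n) , trans (cong toℕ (strictlyInverseˡ (fromℕ< k<n))) (Finₚ.toℕ-fromℕ< k<n)

  adj≡consecutive : ∀ u v → adj G u v ≡ consecutive (pos u) (pos v)
  adj≡consecutive = proj₂ σ

  Adj⇒consecutive : Adj G u v → suc (pos u) ≡ pos v ⊎ suc (pos v) ≡ pos u
  Adj⇒consecutive {u} {v} uv = consecutive⁻ (pos u) (pos v) (trans (sym (adj≡consecutive u v)) uv)

  consecutive⇒Adj : suc (pos u) ≡ pos v → Adj G u v
  consecutive⇒Adj {u} {v} pu+1≡pv =
    trans (adj≡consecutive u v) (subst (λ j → consecutive (pos u) j ≡ true) pu+1≡pv (consecutive-suc (pos u)))

  endpoint-zeroForcing : pos w ≡ 0 → IsZeroForcingSet G ⁅ w ⁆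
  endpoint-zeroForcing {w} pw≡0 v = black-upTo (pos v) ≤-refl
    where
    black-upTo : ∀ j {u} → pos u ≤ j → Black G ⁅ w ⁆ u
    black-upTo zero pu≤0 = init (subst (_∈ ⁅ w ⁆) (pos-injective (trans pw≡0 (sym (n≤0⇒n≡0 pu≤0)))) (x∈⁅x⁆ w))
    black-upTo (suc j) {u} pu≤j+1 with ≤-suc-cases pu≤j+1
    ... | inj₁ pu≤j   = black-upTo j pu≤j
    ... | inj₂ pu≡j+1 with vertexAt (<-trans (n<1+n j) (subst (_< n) pu≡j+1 (pos<n u)))
    ...   | x , px≡j = force (black-upTo j (≤-reflexive px≡j)) (consecutive⇒Adj (trans (cong suc px≡j) (sym pu≡j+1))) others
      where
      others : ∀ y → Adj G x y → y ≢ u → Black G ⁅ w ⁆ y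
      others y xy y≢u with Adj⇒consecutive xy
      ... | inj₁ px+1≡py = ⊥-elim (y≢u (pos-injective (trans (sym px+1≡py) (trans (cong suc px≡j) (sym pu≡j+1)))))
      ... | inj₂ py+1≡px = black-upTo j (≤-trans (n≤1+n (pos y)) (≤-reflexive (trans py+1≡px px≡j)))

  atPosition : ℕ → Subset n
  atPosition k = tabulate (λ u → does (pos u ≟ k))

  ∈atPosition⁺ : pos u ≡ k → u ∈ atPosition k
  ∈atPosition⁺ {u} {k} pu≡k = ∈-tabulate⁺ _ (dec-true (pos u ≟ k) pu≡k)

  ∈atPosition⁻ : u ∈ atPosition k → pos u ≡ k
  ∈atPosition⁻ {u} {k} u∈ with pos u ≟ k
  ... | yes pu≡k = pu≡k
  ... | no pu≢k  with trans (sym (∈-tabulate⁻ _ u∈)) (dec-false (pos u ≟ k) pu≢k)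
  ...   | ()

  degree≤2 : ∀ v → degree G v ≤ 2
  degree≤2 v = begin
    degree G v                  ≤⟨ p⊆q⇒∣p∣≤∣q∣ N⊆ ⟩
    ∣ before ∪ after ∣          ≤⟨ ∣p∪q∣≤∣p∣+∣q∣ before after ⟩
    ∣ before ∣ + ∣ after ∣      ≤⟨ +-mono-≤ (∣atPosition∣≤1 _) (∣atPosition∣≤1 _) ⟩
    2                           ∎
    where
    open ≤-Reasoning
    before after : Subset n
    before = atPosition (pred (pos v))
    after  = atPosition (suc (pos v))
    ∣atPosition∣≤1 : ∀ k → ∣ atPosition k ∣ ≤ 1
    ∣atPosition∣≤1 k = subsingleton⇒∣p∣≤1 λ x∈ y∈ → pos-injective (trans (∈atPosition⁻ x∈) (sym (∈atPosition⁻ y∈)))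
    N⊆ : neighbourhood G v ⊆ before ∪ after
    N⊆ {y} y∈N with Adj⇒consecutive (∈-tabulate⁻ _ y∈N)
    ... | inj₁ pv+1≡py = q⊆p∪q _ _ (∈atPosition⁺ (sym pv+1≡py))
    ... | inj₂ py+1≡pv = p⊆p∪q _ (∈atPosition⁺ (cong pred py+1≡pv))

  ≢at : pos u ≡ i → i ≢ j → pos u ≢ j
  ≢at pu≡i i≢j pu≡j = i≢j (trans (sym pu≡i) pu≡j)

  pos-≢ : pos u ≡ i → pos v ≡ j → i ≢ j → u ≢ v
  pos-≢ pu≡i pv≡j i≢j u≡v = i≢j (trans (sym pu≡i) (trans (cong pos u≡v) pv≡j))

  Gᶜ : Graph n
  Gᶜ = complement G

  n∸3≤complement-degree : ∀ v → n ∸ 3 ≤ degree Gᶜ v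
  n∸3≤complement-degree v = ≤-trans (∸-monoʳ-≤ n (s≤s (degree≤2 v))) (complement-degree≥ G v)

  Adjᶜ-at : pos u ≡ i → pos v ≡ j → consecutive i j ≡ false → i ≢ j → Adj Gᶜ u v
  Adjᶜ-at {u = u} {v = v} pu≡i pv≡j nonconsecutive i≢j =
    complement-adj⁺ G (trans (adj≡consecutive u v) (subst₂ (λ a b → consecutive a b ≡ false) (sym pu≡i) (sym pv≡j) nonconsecutive))
                      (pos-≢ pu≡i pv≡j i≢j)

  ¬Adjᶜ-at : pos u ≡ i → pos v ≡ j → consecutive i j ≡ true → ¬ Adj Gᶜ u v
  ¬Adjᶜ-at {u = u} {v = v} pu≡i pv≡j cons uv
    with trans (sym cons) (subst₂ (λ a b → consecutive a b ≡ false) pu≡i pv≡j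
                (trans (sym (adj≡consecutive u v)) (proj₁ (complement-adj⁻ G uv))))
  ... | ()

  complement-isolated : 2 ≤ n → n ≤ 3 → ∃[ v ] degree Gᶜ v ≡ 0
  complement-isolated 2≤n n≤3 with vertexAt 2≤n
  ... | v , pv≡1 = v , isolated⇒degree≡0 Gᶜ (λ x → ¬Adjᶜ x (pos x) refl (≤-trans (pos<n x) n≤3))
    where
    ¬Adjᶜ : ∀ x j → pos x ≡ j → j < 3 → ¬ Adj Gᶜ v x
    ¬Adjᶜ x 0 px≡0 _ = ¬Adjᶜ-at pv≡1 px≡0 refl
    ¬Adjᶜ x 1 px≡1 _ vx = Adj⇒≢ Gᶜ vx (pos-injective (trans pv≡1 (sym px≡1)))
    ¬Adjᶜ x 2 px≡2 _    = ¬Adjᶜ-at pv≡1 px≡2 refl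
    ¬Adjᶜ x (suc (suc (suc _))) _ (s≤s (s≤s (s≤s ())))

  -- With v₀ … vₗ in path order and forcingSet = V ∖ {v₀, v₂, vₗ}, the forces v₁ → vₗ, v₃ → v₀, v₀ → v₂
  -- colour Gᶜ (for n = 4 the vertices v₃ and vₗ coincide).
  module ComplementOfLongPath (4≤n : 4 ≤ n) where
    instance
      n-nonZero : NonZero n
      n-nonZero = >-nonZero (≤-trans (s≤s z≤n) 4≤n)

    ℓ : ℕ
    ℓ = pred n

    3≤ℓ : 3 ≤ ℓ
    3≤ℓ = pred-mono-≤ 4≤n

    ℓ≢ : i < 3 → i ≢ ℓ
    ℓ≢ i<3 = <⇒≢ (≤-trans i<3 3≤ℓ)

    <4⇒<n : k < 4 → k < n
    <4⇒<n k<4 = ≤-trans k<4 4≤n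

    v₀ v₁ v₂ v₃ vₗ : Fin n
    v₀ = proj₁ (vertexAt (<4⇒<n (s≤s z≤n)))
    v₁ = proj₁ (vertexAt (<4⇒<n (s≤s (s≤s z≤n))))
    v₂ = proj₁ (vertexAt (<4⇒<n (s≤s (s≤s (s≤s z≤n)))))
    v₃ = proj₁ (vertexAt (<4⇒<n ≤-refl))
    vₗ = proj₁ (vertexAt (≤-reflexive (suc-pred n)))

    p₀ : pos v₀ ≡ 0
    p₀ = proj₂ (vertexAt (<4⇒<n (s≤s z≤n)))
    p₁ : pos v₁ ≡ 1
    p₁ = proj₂ (vertexAt (<4⇒<n (s≤s (s≤s z≤n))))
    p₂ : pos v₂ ≡ 2
    p₂ = proj₂ (vertexAt (<4⇒<n (s≤s (s≤s (s≤s z≤n)))))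
    p₃ : pos v₃ ≡ 3
    p₃ = proj₂ (vertexAt (<4⇒<n ≤-refl))
    pₗ : pos vₗ ≡ ℓ
    pₗ = proj₂ (vertexAt (≤-reflexive (suc-pred n)))

    white : Subset n
    white = ⁅ v₀ ⁆ ∪ (⁅ v₂ ⁆ ∪ ⁅ vₗ ⁆)

    forcingSet : Subset n
    forcingSet = ∁ white

    ∈forcingSet : ∀ x → pos x ≢ 0 → pos x ≢ 2 → pos x ≢ ℓ → x ∈ forcingSet
    ∈forcingSet x px≢0 px≢2 px≢ℓ = x∉p⇒x∈∁p x∉white
      where
      x∉white : x ∉ white
      x∉white x∈white with x∈p∪q⁻ ⁅ v₀ ⁆ _ x∈white
      ... | inj₁ x∈⁅v₀⁆ = px≢0 (trans (cong pos (x∈⁅y⁆⇒x≡y v₀ x∈⁅v₀⁆)) p₀)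
      ... | inj₂ x∈ with x∈p∪q⁻ ⁅ v₂ ⁆ ⁅ vₗ ⁆ x∈
      ...   | inj₁ x∈⁅v₂⁆ = px≢2 (trans (cong pos (x∈⁅y⁆⇒x≡y v₂ x∈⁅v₂⁆)) p₂)
      ...   | inj₂ x∈⁅vₗ⁆ = px≢ℓ (trans (cong pos (x∈⁅y⁆⇒x≡y vₗ x∈⁅vₗ⁆)) pₗ)

    black-vₗ : Black Gᶜ forcingSet vₗ
    black-vₗ = force (init (∈forcingSet v₁ (≢at p₁ λ ()) (≢at p₁ λ ()) (≢at p₁ (ℓ≢ (s≤s (s≤s z≤n))))))
                     (Adjᶜ-at p₁ pₗ (consecutive-false (ℓ≢ ≤-refl) (ℓ≢ (s≤s z≤n) ∘ sym ∘ suc-injective)) (ℓ≢ (s≤s (s≤s z≤n))))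
                     λ x v₁x x≢vₗ → init (∈forcingSet x (λ px≡0 → ¬Adjᶜ-at p₁ px≡0 refl v₁x) (λ px≡2 → ¬Adjᶜ-at p₁ px≡2 refl v₁x)
                                               (λ px≡ℓ → x≢vₗ (pos-injective (trans px≡ℓ (sym pₗ)))))

    black-unless-0,2 : ∀ x → pos x ≢ 0 → pos x ≢ 2 → Black Gᶜ forcingSet x
    black-unless-0,2 x px≢0 px≢2 with pos x ≟ ℓ
    ... | yes px≡ℓ = subst (Black Gᶜ forcingSet) (pos-injective (trans pₗ (sym px≡ℓ))) black-vₗ
    ... | no px≢ℓ  = init (∈forcingSet x px≢0 px≢2 px≢ℓ)

    black-v₀ : Black Gᶜ forcingSet v₀
    black-v₀ = force (black-unless-0,2 v₃ (≢at p₃ λ ()) (≢at p₃ λ ())) (Adjᶜ-at p₃ p₀ refl λ ())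
                     λ x v₃x x≢v₀ → black-unless-0,2 x (λ px≡0 → x≢v₀ (pos-injective (trans px≡0 (sym p₀))))
                                                       (λ px≡2 → ¬Adjᶜ-at p₃ px≡2 refl v₃x)

    black-v₂ : Black Gᶜ forcingSet v₂
    black-v₂ = force black-v₀ (Adjᶜ-at p₀ p₂ refl λ ())
                     λ x v₀x x≢v₂ → black-unless-0,2 x (λ px≡0 → Adj⇒≢ Gᶜ v₀x (pos-injective (trans p₀ (sym px≡0))))
                                                       (λ px≡2 → x≢v₂ (pos-injective (trans px≡2 (sym p₂))))

    zeroForcing : IsZeroForcingSet Gᶜ forcingSet
    zeroForcing x with pos x ≟ 0 | pos x ≟ 2
    ... | yes px≡0 | _        = subst (Black Gᶜ forcingSet) (pos-injective (trans p₀ (sym px≡0))) black-v₀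
    ... | no _     | yes px≡2 = subst (Black Gᶜ forcingSet) (pos-injective (trans p₂ (sym px≡2))) black-v₂
    ... | no px≢0  | no px≢2  = black-unless-0,2 x px≢0 px≢2

    ∣forcingSet∣≤n∸3 : ∣ forcingSet ∣ ≤ n ∸ 3
    ∣forcingSet∣≤n∸3 = ≤-trans (≤-reflexive (∣∁p∣≡n∸∣p∣ white)) (∸-monoʳ-≤ n 3≤∣white∣)
      where
      3≤∣white∣ : 3 ≤ ∣ white ∣
      3≤∣white∣ = x,y,z∈p⇒3≤∣p∣ (p⊆p∪q _ (x∈⁅x⁆ v₀)) (q⊆p∪q ⁅ v₀ ⁆ _ (p⊆p∪q ⁅ vₗ ⁆ (x∈⁅x⁆ v₂)))
                            (q⊆p∪q ⁅ v₀ ⁆ _ (q⊆p∪q ⁅ v₂ ⁆ _ (x∈⁅x⁆ vₗ)))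
                            (pos-≢ p₀ p₂ λ ()) (pos-≢ p₀ pₗ (ℓ≢ (s≤s z≤n))) (pos-≢ p₂ pₗ (ℓ≢ ≤-refl))

  zeroForcingNumber≡1 : 1 ≤ n → ∀ {z} → IsZeroForcingNumber G z → z ≡ 1
  zeroForcingNumber≡1 1≤n Z@(_ , minimal) with vertexAt 1≤n
  ... | w , pw≡0 = ≤-antisym (≤-trans (minimal ⁅ w ⁆ (endpoint-zeroForcing pw≡0)) (≤-reflexive (∣⁅x⁆∣≡1 w)))
                             (1≤zeroForcingNumber w Z)

  complement-zeroForcingNumber≡minDegree : 4 ≤ n → ∀ {z d} → IsZeroForcingNumber Gᶜ z → IsMinDegree Gᶜ d → z ≡ d
  complement-zeroForcingNumber≡minDegree 4≤n {z} {d} Z δ@((v , deg-v≡d) , _) = ≤-antisym z≤d (minDegree≤zeroForcingNumber δ Z)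
    where
    open ComplementOfLongPath 4≤n
    open ≤-Reasoning
    z≤d : z ≤ d
    z≤d = begin
      z              ≤⟨ proj₂ Z forcingSet zeroForcing ⟩
      ∣ forcingSet ∣ ≤⟨ ∣forcingSet∣≤n∸3 ⟩
      n ∸ 3          ≤⟨ n∸3≤complement-degree v ⟩
      degree Gᶜ v    ≡⟨ deg-v≡d ⟩
      d              ∎

  4≤order : IsMinDegree G 1 → (∀ v → 1 ≤ degree Gᶜ v) → 4 ≤ n
  4≤order ((v , deg-v≡1) , _) Gᶜ-has-no-isolated with 4 ≤? n | 2 ≤? n
  ... | yes 4≤n | _       = 4≤n
  ... | no 4≰n  | yes 2≤n with complement-isolated 2≤n (s≤s⁻¹ (≰⇒> 4≰n))
  ...   | x , deg-x≡0 = ⊥-elim (1+n≰n (≤-trans (Gᶜ-has-no-isolated x) (≤-reflexive deg-x≡0)))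
  4≤order ((v , deg-v≡1) , _) _ | no _ | no 2≰n = ⊥-elim (0≢1+n (trans (sym (isolated⇒degree≡0 G isolated)) deg-v≡1))
    where
    isolated : ∀ x → ¬ Adj G v x
    isolated x vx = Adj⇒≢ G vx (pos-injective (trans (n<1⇒n≡0 (≤-trans (pos<n v) n≤1)) (sym (n<1⇒n≡0 (≤-trans (pos<n x) n≤1)))))
      where
      n≤1 : n ≤ 1
      n≤1 = s≤s⁻¹ (≰⇒> 2≰n)

Visited : ℕ → (ℕ → Fin n) → Fin n → Set
Visited k g x = ∃[ j ] j ≤ k × g j ≡ x

visited? : ∀ k (g : ℕ → Fin n) x → Dec (Visited k g x)
visited? k g x with Finₚ.any? (λ (j : Fin (suc k)) → g (toℕ j) Finₚ.≟ x)
... | yes (j , gj≡x) = yes (toℕ j , s≤s⁻¹ (Finₚ.toℕ<n j) , gj≡x)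
... | no none        = no λ (j , j≤k , gj≡x) → none (fromℕ< (s≤s j≤k) , trans (cong g (Finₚ.toℕ-fromℕ< (s≤s j≤k))) gj≡x)

InjectiveUpTo : ℕ → (ℕ → Fin n) → Set
InjectiveUpTo k g = ∀ {i j} → i ≤ k → j ≤ k → g i ≡ g j → i ≡ j

allVisited⇒n≤1+k : (g : ℕ → Fin n) → (∀ x → Visited k g x) → n ≤ suc k
allVisited⇒n≤1+k {n} {k} g visited = Finₚ.injective⇒≤ {f = index} index-injective
  where
  index : Fin n → Fin (suc k)
  index x = fromℕ< (s≤s (proj₁ (proj₂ (visited x))))
  g∘index : ∀ x → g (toℕ (index x)) ≡ x
  g∘index x = trans (cong g (Finₚ.toℕ-fromℕ< _)) (proj₂ (proj₂ (visited x)))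
  index-injective : ∀ {x y} → index x ≡ index y → x ≡ y
  index-injective {x} {y} eq = trans (sym (g∘index x)) (trans (cong (g ∘ toℕ) eq) (g∘index y))

unvisited⇒2+k≤n : (g : ℕ → Fin n) → InjectiveUpTo k g → ¬ Visited k g x → suc (suc k) ≤ n
unvisited⇒2+k≤n {k = k} {x = x} g g-injective unvisited = Finₚ.injective⇒≤ {f = h} h-injective
  where
  h : Fin (suc (suc k)) → _
  h Fin.zero    = x
  h (Fin.suc i) = g (toℕ i)
  h-injective : ∀ {i j} → h i ≡ h j → i ≡ j
  h-injective {Fin.zero}  {Fin.zero}  _   = refl
  h-injective {Fin.zero}  {Fin.suc j} x≡ = ⊥-elim (unvisited (toℕ j , s≤s⁻¹ (Finₚ.toℕ<n j) , sym x≡))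
  h-injective {Fin.suc i} {Fin.zero}  ≡x = ⊥-elim (unvisited (toℕ i , s≤s⁻¹ (Finₚ.toℕ<n i) , ≡x))
  h-injective {Fin.suc i} {Fin.suc j} eq =
    cong Fin.suc (Finₚ.toℕ-injective (g-injective (s≤s⁻¹ (Finₚ.toℕ<n i)) (s≤s⁻¹ (Finₚ.toℕ<n j)) eq))

_[_≔_] : (ℕ → A) → ℕ → A → ℕ → A
(g [ k ≔ a ]) i = if does (i ≟ k) then a else g i

[≔]-updated : (g : ℕ → A) (a : A) → (g [ k ≔ a ]) k ≡ a
[≔]-updated {k = k} g a rewrite dec-true (k ≟ k) refl = refl

[≔]-unchanged : ∀ {i} (g : ℕ → A) (a : A) → i ≢ k → (g [ k ≔ a ]) i ≡ g i
[≔]-unchanged {k = k} {i} g a i≢k rewrite dec-false (i ≟ k) i≢k = refl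

module SingletonForcing {m} (G : Graph (suc m)) (s : Fin (suc m)) (zfs : IsZeroForcingSet G ⁅ s ⁆) where

  -- The first k + 1 vertices forced from s, in order; all but the last have already forced,
  -- so they have no neighbours off the chain.
  record ForcingChain (k : ℕ) : Set where
    field
      vertex    : ℕ → Fin (suc m)
      starts    : vertex 0 ≡ s
      injective : InjectiveUpTo k vertex
      induced   : ∀ {i j} → i ≤ k → j ≤ k → adj G (vertex i) (vertex j) ≡ consecutive i j
      closed    : ∀ {i x} → i < k → Adj G (vertex i) x → Visited k vertex x

  trivialChain : ForcingChain 0
  trivialChain = record
    { vertex    = λ _ → s
    ; starts    = refl
    ; injective = λ { z≤n z≤n _ → refl }
    ; induced   = λ { z≤n z≤n → irrefl G s }
    ; closed    = λ ()
    }

  -- An escaping force must start at the last vertex, since all others are closed;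
  -- its target is adjacent to no earlier vertex for the same reason.
  module Extend {k} (c : ForcingChain k) (F : EscapingForce G (Visited k (ForcingChain.vertex c))) where
    open ForcingChain c
    open EscapingForce F

    last≡source : vertex k ≡ source
    last≡source with source∈B
    ... | i , i≤k , vi≡source with m≤n⇒m<n∨m≡n i≤k
    ...   | inj₁ i<k = ⊥-elim (target∉B (closed i<k (subst (λ v → Adj G v target) (sym vi≡source) edge)))
    ...   | inj₂ refl = vi≡source

    vertex′ : ℕ → Fin (suc m)
    vertex′ = vertex [ suc k ≔ target ]

    vertex′-old : ∀ {i} → i ≤ k → vertex′ i ≡ vertex i
    vertex′-old i≤k = [≔]-unchanged vertex target (<⇒≢ (s≤s i≤k))

    vertex′-new : vertex′ (suc k) ≡ target
    vertex′-new = [≔]-updated vertex target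

    adj-target : ∀ {i} → i ≤ k → adj G (vertex i) target ≡ consecutive i (suc k)
    adj-target {i} i≤k with m≤n⇒m<n∨m≡n i≤k
    ... | inj₁ i<k  = trans (¬-not (target∉B ∘ closed i<k))
                            (sym (consecutive-false (<⇒≢ (s≤s i<k)) (>⇒≢ (m<n⇒m<1+n (m<n⇒m<1+n i<k)))))
    ... | inj₂ refl = trans (subst (λ v → adj G v target ≡ true) (sym last≡source) edge) (sym (consecutive-suc i))

    injective′ : InjectiveUpTo (suc k) vertex′
    injective′ {i} {j} i≤ j≤ eq with ≤-suc-cases i≤ | ≤-suc-cases j≤
    ... | inj₁ i≤k  | inj₁ j≤k  = injective i≤k j≤k (trans (sym (vertex′-old i≤k)) (trans eq (vertex′-old j≤k)))
    ... | inj₁ i≤k  | inj₂ refl = ⊥-elim (target∉B (i , i≤k , trans (sym (vertex′-old i≤k)) (trans eq vertex′-new)))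
    ... | inj₂ refl | inj₁ j≤k  = ⊥-elim (target∉B (j , j≤k , trans (sym (vertex′-old j≤k)) (trans (sym eq) vertex′-new)))
    ... | inj₂ refl | inj₂ refl = refl

    induced′ : ∀ {i j} → i ≤ suc k → j ≤ suc k → adj G (vertex′ i) (vertex′ j) ≡ consecutive i j
    induced′ {i} {j} i≤ j≤ with ≤-suc-cases i≤ | ≤-suc-cases j≤
    ... | inj₁ i≤k  | inj₁ j≤k  rewrite vertex′-old i≤k | vertex′-old j≤k = induced i≤k j≤k
    ... | inj₁ i≤k  | inj₂ refl rewrite vertex′-old i≤k | vertex′-new = adj-target i≤k
    ... | inj₂ refl | inj₁ j≤k  rewrite vertex′-old j≤k | vertex′-new =
      trans (adj-sym G target (vertex j)) (trans (adj-target j≤k) (consecutive-sym j (suc k)))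
    ... | inj₂ refl | inj₂ refl = trans (irrefl G _) (sym (consecutive-irrefl (suc k)))

    visited′ : ∀ {x} → Visited k vertex x → Visited (suc k) vertex′ x
    visited′ (j , j≤k , vj≡x) = j , m≤n⇒m≤1+n j≤k , trans (vertex′-old j≤k) vj≡x

    closed′ : ∀ {i x} → i < suc k → Adj G (vertex′ i) x → Visited (suc k) vertex′ x
    closed′ {i} {x} i<k+1 ix with m≤n⇒m<n∨m≡n (s≤s⁻¹ i<k+1)
    ... | inj₁ i<k  = visited′ (closed i<k (subst (λ v → Adj G v x) (vertex′-old (<⇒≤ i<k)) ix))
    ... | inj₂ refl with x Finₚ.≟ target
    ...   | yes refl    = suc k , ≤-refl , vertex′-new
    ...   | no x≢target =
      visited′ (others∈B x (subst (λ v → Adj G v x) (trans (vertex′-old ≤-refl) last≡source) ix) x≢target)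

    chain′ : ForcingChain (suc k)
    chain′ = record
      { vertex = vertex′ ; starts = trans (vertex′-old z≤n) starts
      ; injective = injective′ ; induced = induced′ ; closed = closed′ }

  module _ {k} (c : ForcingChain k) where
    open ForcingChain c

    grow : suc k < suc m → ForcingChain (suc k)
    grow k+1<n with Finₚ.all? (visited? k vertex)
    ... | yes allVisited = ⊥-elim (<⇒≱ k+1<n (allVisited⇒n≤1+k vertex allVisited))
    ... | no ¬allVisited with Finₚ.¬∀⟶∃¬ _ _ (visited? k vertex) ¬allVisited
    ...   | x , unvisited = Extend.chain′ c (escapingForce (visited? k vertex) s-visited (zfs x) unvisited)
      where
      s-visited : ∀ {x} → x ∈ ⁅ s ⁆ → Visited k vertex x
      s-visited x∈⁅s⁆ = 0 , z≤n , trans starts (sym (x∈⁅y⁆⇒x≡y s x∈⁅s⁆))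

  chain : ∀ k → k < suc m → ForcingChain k
  chain zero    _     = trivialChain
  chain (suc k) k+1<n = grow (chain k (<-trans (n<1+n k) k+1<n)) k+1<n

  ≅path : G ≅ path (suc m)
  ≅path = mk↔ₛ′ to from to∘from from∘to , adj≡consecutive
    where
    open ForcingChain (chain m ≤-refl)
    from : Fin (suc m) → Fin (suc m)
    from i = vertex (toℕ i)
    from-injective : ∀ {i j} → from i ≡ from j → i ≡ j
    from-injective {i} {j} = Finₚ.toℕ-injective ∘ injective (Finₚ.toℕ≤pred[n] i) (Finₚ.toℕ≤pred[n] j)
    allVisited : ∀ x → Visited m vertex x
    allVisited x with visited? m vertex x
    ... | yes visited  = visited
    ... | no unvisited = ⊥-elim (1+n≰n (unvisited⇒2+k≤n vertex injective unvisited))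
    to : Fin (suc m) → Fin (suc m)
    to x = fromℕ< (s≤s (proj₁ (proj₂ (allVisited x))))
    from∘to : ∀ x → from (to x) ≡ x
    from∘to x = trans (cong vertex (Finₚ.toℕ-fromℕ< _)) (proj₂ (proj₂ (allVisited x)))
    to∘from : ∀ i → to (from i) ≡ i
    to∘from i = from-injective (from∘to (from i))
    adj≡consecutive : ∀ u v → adj G u v ≡ consecutive (toℕ (to u)) (toℕ (to v))
    adj≡consecutive u v = subst₂ (λ a b → adj G a b ≡ consecutive (toℕ (to u)) (toℕ (to v))) (from∘to u) (from∘to v)
                                 (induced (Finₚ.toℕ≤pred[n] (to u)) (Finₚ.toℕ≤pred[n] (to v)))

zeroForcingNumber≡1⇒≅path : (G : Graph n) → IsZeroForcingNumber G 1 → G ≅ path n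
zeroForcingNumber≡1⇒≅path G Z with zeroForcingNumber≡1⇒singleton Z
zeroForcingNumber≡1⇒≅path {suc m} G Z | s , zfs = SingletonForcing.≅path G s zfs

+-tight : 1 ≤ i → k ≤ j → i + j ≡ 1 + k → i ≡ 1 × j ≡ k
+-tight {suc zero}    _ _   eq = refl , suc-injective eq
+-tight {suc (suc i)} {k} {j} _ k≤j eq = ⊥-elim (<-irrefl refl (begin-strict
  j          <⟨ s≤s (m≤n+m j i) ⟩
  suc i + j  ≡⟨ suc-injective eq ⟩
  k          ≤⟨ k≤j ⟩
  j          ∎))
  where open ≤-Reasoning

proposition3p1 : (n : ℕ) (G : Graph n) → Connected G → IsMinDegree G 1 →
                 (z₁ z₂ d₂ : ℕ) → IsZeroForcingNumber G z₁ →
                 IsZeroForcingNumber (complement G) z₂ →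
                 IsMinDegree (complement G) d₂ →
                 ((z₁ + z₂ ≡ 1 + d₂) ⇔ (G ≅ path n × n ≥ 4))
proposition3p1 n G _ δG z₁ z₂ d₂ Z₁ Z₂ δGᶜ = mk⇔ forward backward
  where
  w₀ : Fin n
  w₀ = proj₁ (proj₁ δG)

  forward : z₁ + z₂ ≡ 1 + d₂ → G ≅ path n × n ≥ 4
  forward eq with +-tight (1≤zeroForcingNumber w₀ Z₁) (minDegree≤zeroForcingNumber δGᶜ Z₂) eq
  ... | refl , refl = σ , PathLabelling.4≤order G σ δG
                              (λ x → ≤-trans (1≤zeroForcingNumber w₀ Z₂) (proj₂ δGᶜ x))
    where
    σ : G ≅ path n
    σ = zeroForcingNumber≡1⇒≅path G Z₁

  backward : G ≅ path n × n ≥ 4 → z₁ + z₂ ≡ 1 + d₂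
  backward (σ , 4≤n) = cong₂ _+_ (zeroForcingNumber≡1 (≤-trans (s≤s z≤n) 4≤n) Z₁)
                                 (complement-zeroForcingNumber≡minDegree 4≤n Z₂ δGᶜ)
    where open PathLabelling G σ
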